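{- Let $G$ be a finite 2-edge-connected graph and $k\ge 2$ an integer. If the reconfiguration graph $\mathcal{F}(G,k)$ is non-empty, then every vertex of $\mathcal{F}(G,k)$ has degree at least $1$.
   Context: Graphs may have multiple edges but no loops. Fix an orientation $D$ of the edges of $G$. A $\mathbb{Z}$-flow in $G$ is a map $f:E(G)\to\mathbb{Z}$ such that at every vertex $v$, the sum of $f(e)$ over arcs with tail $v$ equals the sum over arcs with head $v$. A $k$-flow is a $\mathbb{Z}$-flow with $|f(e)|<k$ for all edges $e$; it is nowhere-zero if $f(e)\ne 0$ for all $e$. The support $\mathrm{supp}(f)$ is the set of edges with non-zero value. A cycle is a connected 2-regular subgraph. The reconfiguration graph $\mathcal{F}(G,k)$ has as vertices all nowhere-zero $k$-flows of $G$ (with respect to the fixed orientation), two flows $f,g$ being adjacent if $\mathrm{supp}(f-g)$ is the edge set of a cycle of $G$. -}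

module Defs where

open import Data.Nat using (ℕ; zero; suc; _<_; _≤_)
open import Data.Integer as ℤ using (ℤ; ∣_∣) renaming (_+_ to _+ℤ_; _-_ to _-ℤ_)
import Data.Integer.Properties as ℤP
open import Data.Fin using (Fin)
open import Data.Fin.Properties using () renaming (_≟_ to _≟F_)
open import Data.List using (List; map; foldr)
open import Data.List.Base using (allFin)
open import Data.Bool using (Bool; true; false; if_then_else_; not; _∨_; _∧_)
open import Data.Product using (Σ; _×_; ∃)
open import Data.Sum using (_⊎_)
open import Relation.Nullary using (¬_)
open import Relation.Nullary.Decidable using (⌊_⌋)
open import Relation.Binary.PropositionalEquality using (_≡_; _≢_)

-- A finite multigraph without loops, together with a fixed orientation:
-- vertices Fin n, edges Fin m, edge e is the arc  tail e → head e.
record Graph : Set where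
  field
    n     : ℕ
    m     : ℕ
    tail  : Fin m → Fin n
    head  : Fin m → Fin n
    noLoop : ∀ e → tail e ≢ head e
open Graph public

data Reach (G : Graph) (A : Fin (m G) → Set) : Fin (n G) → Fin (n G) → Set where
  here  : ∀ {u} → Reach G A u u
  fwd   : ∀ {v} (e : Fin (m G)) → A e → Reach G A (head G e) v → Reach G A (tail G e) v
  bwd   : ∀ {v} (e : Fin (m G)) → A e → Reach G A (tail G e) v → Reach G A (head G e) v

ConnectedVia : (G : Graph) → (Fin (m G) → Set) → Set
ConnectedVia G A = ∀ u v → Reach G A u v

-- 2-edge-connected (Diestel): at least 2 vertices and G − F connected for every |F| < 2.
TwoEdgeConnected : Graph → Set
TwoEdgeConnected G =
  (2 ≤ n G)
  × ConnectedVia G (λ _ → Data.Unit.⊤)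
  × (∀ (f : Fin (m G)) → ConnectedVia G (λ e → e ≢ f))
  where import Data.Unit

sumℤ : List ℤ → ℤ
sumℤ = foldr _+ℤ_ (ℤ.+ 0)

outSum : (G : Graph) → (Fin (m G) → ℤ) → Fin (n G) → ℤ
outSum G f v = sumℤ (map (λ e → if ⌊ tail G e ≟F v ⌋ then f e else ℤ.+ 0) (allFin (m G)))

inSum : (G : Graph) → (Fin (m G) → ℤ) → Fin (n G) → ℤ
inSum G f v = sumℤ (map (λ e → if ⌊ head G e ≟F v ⌋ then f e else ℤ.+ 0) (allFin (m G)))

IsZFlow : (G : Graph) → (Fin (m G) → ℤ) → Set
IsZFlow G f = ∀ v → outSum G f v ≡ inSum G f v

IsNZkFlow : (G : Graph) → ℕ → (Fin (m G) → ℤ) → Set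
IsNZkFlow G k f = IsZFlow G f × (∀ e → ∣ f e ∣ < k) × (∀ e → f e ≢ ℤ.+ 0)

supp : (G : Graph) → (Fin (m G) → ℤ) → Fin (m G) → Bool
supp G h e = not ⌊ h e ℤ.≟ ℤ.+ 0 ⌋

-- Number of edges of the edge set C incident with v (no loops, so each counts once).
degIn : (G : Graph) → (Fin (m G) → Bool) → Fin (n G) → ℕ
degIn G C v = Data.Nat.ListAction.sum (map (λ e → if C e ∧ (⌊ tail G e ≟F v ⌋ ∨ ⌊ head G e ≟F v ⌋) then 1 else 0) (allFin (m G)))
  where import Data.Nat.ListAction

-- C is the edge set of a cycle (a connected 2-regular subgraph): C is non-empty,
-- every vertex meets 0 or 2 edges of C, and any two edges of C are joined by a walk in C.
IsCycleEdgeSet : (G : Graph) → (Fin (m G) → Bool) → Set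
IsCycleEdgeSet G C =
  (∃ λ e → C e ≡ true)
  × (∀ v → degIn G C v ≡ 0 ⊎ degIn G C v ≡ 2)
  × (∀ e e' → C e ≡ true → C e' ≡ true → Reach G (λ d → C d ≡ true) (tail G e) (tail G e'))

AdjacentFlows : (G : Graph) → (Fin (m G) → ℤ) → (Fin (m G) → ℤ) → Set
AdjacentFlows G f g = IsCycleEdgeSet G (supp G (λ e → f e -ℤ g e))

{-# OPTIONS --safe #-}
module Submission where

-- Reverse every arc on which f is negative, so that f becomes positive.  Flow
-- conservation then gives every vertex (none is isolated) an outgoing arc; choosing
-- one per vertex yields a successor map on the finite vertex set, and the orbit of a
-- periodic point traces a directed cycle C.  Subtracting k along C, with the sign of f
-- on each edge, preserves conservation, and since 0 < |f e| < k the new value on C has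
-- absolute value k - |f e|, strictly between 0 and k.  The difference of the two flows
-- is supported exactly on C.

open import Defs
open import Algebra.Bundles using (CommutativeMonoid)
open import Data.Bool using (Bool; true; false; if_then_else_; not; _∧_; _∨_)
open import Data.Bool.Properties using (∧-zeroʳ)
open import Data.Fin using (Fin; zero; suc; toℕ; fromℕ<)
open import Data.Fin.Properties using (any?; pigeonhole; suc-injective; toℕ-fromℕ<; toℕ<n)
  renaming (_≟_ to _≟F_)
open import Data.Integer as ℤ using (ℤ; +_; +[1+_]; -[1+_]; ∣_∣; sign; _◃_; _⊖_)
  renaming (_+_ to _+ℤ_; _-_ to _-ℤ_)
import Data.Integer.Properties as ℤP
open import Data.Integer.Tactic.RingSolver using (solve-∀)
open import Data.List as List using (allFin)
open import Data.List.Properties using (map-tabulate; map-cong)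
open import Data.Nat as ℕ using (ℕ; zero; suc; _≤_; _<_; _∸_)
import Data.Nat.ListAction as ℕList
import Data.Nat.Properties as ℕP
open import Data.Product using (∃; ∃₂; _×_; _,_; proj₁; proj₂)
open import Data.Sign as Sign using (Sign)
open import Data.Sum using (_⊎_; inj₁; inj₂; [_,_])
open import Function using (_∘_; id)
open import Relation.Binary.PropositionalEquality
  using (_≡_; _≢_; refl; sym; trans; cong; cong₂; cong-app; subst; subst₂; module ≡-Reasoning)
open import Relation.Nullary using (¬_; yes; no; contradiction)
open import Relation.Nullary.Decidable using (⌊_⌋; _×-dec_)
open import Relation.Unary using (Decidable)

∣x-sign◃k∣≡k∸∣x∣ : ∀ x k → x ≢ + 0 → ∣ x ∣ ≤ k → ∣ x -ℤ (sign x ◃ k) ∣ ≡ k ∸ ∣ x ∣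
∣x-sign◃k∣≡k∸∣x∣ (+ zero)   k x≢0 _ = contradiction refl x≢0
∣x-sign◃k∣≡k∸∣x∣ +[1+ n ]   k _   ∣x∣≤k = begin
  ∣ +[1+ n ] -ℤ (Sign.+ ◃ k) ∣  ≡⟨ cong (λ y → ∣ +[1+ n ] -ℤ y ∣) (ℤP.+◃n≡+n k) ⟩
  ∣ +[1+ n ] -ℤ + k ∣           ≡⟨ cong ∣_∣ (ℤP.[+m]-[+n]≡m⊖n (suc n) k) ⟩
  ∣ suc n ⊖ k ∣                 ≡⟨ ℤP.∣⊖∣-≤ ∣x∣≤k ⟩
  k ∸ suc n                     ∎
  where open ≡-Reasoning
∣x-sign◃k∣≡k∸∣x∣ -[1+ n ]   k _   ∣x∣≤k = begin
  ∣ -[1+ n ] -ℤ (Sign.- ◃ k) ∣   ≡⟨ cong (λ y → ∣ -[1+ n ] -ℤ y ∣) (ℤP.-◃n≡-n k) ⟩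
  ∣ -[1+ n ] +ℤ ℤ.- (ℤ.- + k) ∣  ≡⟨ cong (λ y → ∣ -[1+ n ] +ℤ y ∣) (ℤP.neg-involutive (+ k)) ⟩
  ∣ ℤ.- + suc n +ℤ + k ∣         ≡⟨ cong ∣_∣ (ℤP.-m+n≡n⊖m (suc n) k) ⟩
  ∣ k ⊖ suc n ∣                  ≡⟨ ℤP.∣m⊖n∣≡∣n⊖m∣ k (suc n) ⟩
  ∣ suc n ⊖ k ∣                  ≡⟨ ℤP.∣⊖∣-≤ ∣x∣≤k ⟩
  k ∸ suc n                      ∎
  where open ≡-Reasoning

sign-shift-in-range : ∀ {k} x → x ≢ + 0 → ∣ x ∣ < k →
                      ∣ x -ℤ (sign x ◃ k) ∣ < k × x -ℤ (sign x ◃ k) ≢ + 0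
sign-shift-in-range {k} x x≢0 ∣x∣<k =
    subst (_< k) (sym shifted) (ℕP.∸-monoʳ-< 0<∣x∣ (ℕP.<⇒≤ ∣x∣<k))
  , λ y≡0 → ℕP.m>n⇒m∸n≢0 ∣x∣<k (trans (sym shifted) (cong ∣_∣ y≡0))
  where
  shifted : ∣ x -ℤ (sign x ◃ k) ∣ ≡ k ∸ ∣ x ∣
  shifted = ∣x-sign◃k∣≡k∸∣x∣ x k x≢0 (ℕP.<⇒≤ ∣x∣<k)
  0<∣x∣ : 0 < ∣ x ∣
  0<∣x∣ = ℕP.n≢0⇒n>0 (x≢0 ∘ ℤP.∣i∣≡0⇒i≡0)

x-[x-y]≡y : ∀ x y → x -ℤ (x -ℤ y) ≡ y
x-[x-y]≡y = solve-∀

module _ {G : Graph} {A : Fin (m G) → Set} where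

  Reach-trans : ∀ {x y z} → Reach G A x y → Reach G A y z → Reach G A x z
  Reach-trans here        r′ = r′
  Reach-trans (fwd e a r) r′ = fwd e a (Reach-trans r r′)
  Reach-trans (bwd e a r) r′ = bwd e a (Reach-trans r r′)

  Reach-sym : ∀ {x y} → Reach G A x y → Reach G A y x
  Reach-sym here        = here
  Reach-sym (fwd e a r) = Reach-trans (Reach-sym r) (bwd e a here)
  Reach-sym (bwd e a r) = Reach-trans (Reach-sym r) (fwd e a here)

  Reach-map : ∀ {B : Fin (m G) → Set} {x y} → (∀ {e} → A e → B e) → Reach G A x y → Reach G B x y
  Reach-map A⇒B here        = here
  Reach-map A⇒B (fwd e a r) = fwd e (A⇒B a) (Reach-map A⇒B r)
  Reach-map A⇒B (bwd e a r) = bwd e (A⇒B a) (Reach-map A⇒B r)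

Incident : (G : Graph) → Fin (n G) → Fin (m G) → Set
Incident G v e = tail G e ≡ v ⊎ head G e ≡ v

another-element : ∀ {k} → 2 ≤ k → (v : Fin k) → ∃ λ w → v ≢ w
another-element (ℕ.s≤s (ℕ.s≤s _)) zero    = suc zero , λ ()
another-element (ℕ.s≤s (ℕ.s≤s _)) (suc v) = zero , λ ()

Reach-incident : ∀ {G A v w} → Reach G A v w → v ≢ w → ∃ (Incident G v)
Reach-incident here        v≢v = contradiction refl v≢v
Reach-incident (fwd e _ _) _   = e , inj₁ refl
Reach-incident (bwd e _ _) _   = e , inj₂ refl

no-isolated-vertex : ∀ {G A} → 2 ≤ n G → ConnectedVia G A → ∀ v → ∃ (Incident G v)
no-isolated-vertex two connected v with w , v≢w ← another-element two v =
  Reach-incident (connected v w) v≢w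

-- Finite sums

module FinSum {c ℓ} (M : CommutativeMonoid c ℓ) where
  open CommutativeMonoid M
    using (Carrier; _≈_; _∙_; ε; setoid; ∙-congˡ; ∙-congʳ; identityˡ; identityʳ; comm)
    renaming (trans to ≈-trans)
  open import Algebra.Properties.CommutativeMonoid.Sum M public
    using (sum; sum-cong-≗; ∑-distrib-+)
  open import Algebra.Properties.CommutativeMonoid.Sum M
    using (sum-cong-≋; sum-replicate-zero)
  open import Relation.Binary.Reasoning.Setoid setoid

  foldr-map-allFin : ∀ {m} (φ : Fin m → Carrier) →
                     List.foldr _∙_ ε (List.map φ (allFin m)) ≡ sum φ
  foldr-map-allFin φ = trans (cong (List.foldr _∙_ ε) (map-tabulate id φ)) (foldr-tabulate φ)
    where
    foldr-tabulate : ∀ {m} (φ : Fin m → Carrier) → List.foldr _∙_ ε (List.tabulate φ) ≡ sum φ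
    foldr-tabulate {zero}  φ = refl
    foldr-tabulate {suc m} φ = cong (φ zero ∙_) (foldr-tabulate (φ ∘ suc))

  sum-zero : ∀ {m} (φ : Fin m → Carrier) → (∀ i → φ i ≈ ε) → sum φ ≈ ε
  sum-zero {m} φ φ≈ε = ≈-trans (sum-cong-≋ φ≈ε) (sum-replicate-zero m)

  sum-point : ∀ {m} (φ : Fin m → Carrier) {x} → (∀ i → i ≢ x → φ i ≈ ε) → sum φ ≈ φ x
  sum-point φ {zero} off = ≈-trans (∙-congˡ (sum-zero (φ ∘ suc) (λ i → off (suc i) λ ()))) (identityʳ _)
  sum-point φ {suc x} off = begin
    φ zero ∙ sum (φ ∘ suc)  ≈⟨ ∙-congʳ (off zero λ ()) ⟩
    ε ∙ sum (φ ∘ suc)       ≈⟨ identityˡ _ ⟩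
    sum (φ ∘ suc)           ≈⟨ sum-point (φ ∘ suc) (λ i i≢x → off (suc i) (i≢x ∘ suc-injective)) ⟩
    φ (suc x)               ∎

  sum-pair : ∀ {m} (φ : Fin m → Carrier) {x y} → x ≢ y →
             (∀ i → i ≢ x → i ≢ y → φ i ≈ ε) → sum φ ≈ φ x ∙ φ y
  sum-pair φ {zero}  {zero}  x≢y _   = contradiction refl x≢y
  sum-pair φ {zero}  {suc y} _   off =
    ∙-congˡ (sum-point (φ ∘ suc) (λ i i≢y → off (suc i) (λ ()) (i≢y ∘ suc-injective)))
  sum-pair φ {suc x} {zero}  _   off = ≈-trans
    (∙-congˡ (sum-point (φ ∘ suc) (λ i i≢x → off (suc i) (i≢x ∘ suc-injective) (λ ()))))
    (comm _ _)
  sum-pair φ {suc x} {suc y} x≢y off = begin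
    φ zero ∙ sum (φ ∘ suc)  ≈⟨ ∙-congʳ (off zero (λ ()) (λ ())) ⟩
    ε ∙ sum (φ ∘ suc)       ≈⟨ identityˡ _ ⟩
    sum (φ ∘ suc)           ≈⟨ sum-pair (φ ∘ suc) (x≢y ∘ cong suc) off′ ⟩
    φ (suc x) ∙ φ (suc y)   ∎
    where
    off′ : ∀ i → i ≢ x → i ≢ y → φ (suc i) ≈ ε
    off′ i i≢x i≢y = off (suc i) (i≢x ∘ suc-injective) (i≢y ∘ suc-injective)

module ℕSum = FinSum ℕP.+-0-commutativeMonoid

module ℤSum where
  open FinSum ℤP.+-0-commutativeMonoid public

  ∑-neg : ∀ {m} (φ : Fin m → ℤ) → sum (λ i → ℤ.- φ i) ≡ ℤ.- sum φ
  ∑-neg {zero}  φ = refl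
  ∑-neg {suc m} φ = trans (cong (ℤ.- φ zero +ℤ_) (∑-neg (φ ∘ suc))) (sym (ℤP.neg-distrib-+ (φ zero) _))

  ∑-− : ∀ {m} (φ ψ : Fin m → ℤ) → sum (λ i → φ i -ℤ ψ i) ≡ sum φ -ℤ sum ψ
  ∑-− φ ψ = trans (∑-distrib-+ φ (ℤ.-_ ∘ ψ)) (cong (sum φ +ℤ_) (∑-neg ψ))

  ∑-mono-≤ : ∀ {m} {φ ψ : Fin m → ℤ} → (∀ i → φ i ℤ.≤ ψ i) → sum φ ℤ.≤ sum ψ
  ∑-mono-≤ {zero}  _   = ℤP.≤-refl
  ∑-mono-≤ {suc m} φ≤ψ = ℤP.+-mono-≤ (φ≤ψ zero) (∑-mono-≤ (φ≤ψ ∘ suc))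

  ∑-mono-< : ∀ {m} {φ ψ : Fin m → ℤ} → (∀ i → φ i ℤ.≤ ψ i) → ∀ x → φ x ℤ.< ψ x → sum φ ℤ.< sum ψ
  ∑-mono-< φ≤ψ zero    φ<ψ = ℤP.+-mono-<-≤ φ<ψ (∑-mono-≤ (φ≤ψ ∘ suc))
  ∑-mono-< φ≤ψ (suc x) φ<ψ = ℤP.+-mono-≤-< (φ≤ψ zero) (∑-mono-< (φ≤ψ ∘ suc) x φ<ψ)

-- outSum G and inSum G are endSum G (tail G) and endSum G (head G) by definition,
-- and degIn G C v sums degTerm G C v.
endTerm : (G : Graph) → (Fin (m G) → Fin (n G)) → (Fin (m G) → ℤ) → Fin (n G) → Fin (m G) → ℤ
endTerm G end φ v e = if ⌊ end e ≟F v ⌋ then φ e else + 0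

endSum : (G : Graph) → (Fin (m G) → Fin (n G)) → (Fin (m G) → ℤ) → Fin (n G) → ℤ
endSum G end φ v = sumℤ (List.map (endTerm G end φ v) (allFin (m G)))

degTerm : (G : Graph) → (Fin (m G) → Bool) → Fin (n G) → Fin (m G) → ℕ
degTerm G C v e = if C e ∧ (⌊ tail G e ≟F v ⌋ ∨ ⌊ head G e ≟F v ⌋) then 1 else 0

module _ (G : Graph) (end : Fin (m G) → Fin (n G)) (φ : Fin (m G) → ℤ) {v : Fin (n G)} where

  endTerm-≡ : ∀ {e} → end e ≡ v → endTerm G end φ v e ≡ φ e
  endTerm-≡ {e} eq with end e ≟F v
  ... | yes _  = refl
  ... | no  ne = contradiction eq ne

  endTerm-≢ : ∀ {e} → end e ≢ v → endTerm G end φ v e ≡ + 0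
  endTerm-≢ {e} ne with end e ≟F v
  ... | yes eq = contradiction eq ne
  ... | no  _  = refl

  endTerm-zero : ∀ {e} → φ e ≡ + 0 → endTerm G end φ v e ≡ + 0
  endTerm-zero {e} φe≡0 with end e ≟F v
  ... | yes _ = φe≡0
  ... | no  _ = refl

  endSum≡sum : endSum G end φ v ≡ ℤSum.sum (endTerm G end φ v)
  endSum≡sum = ℤSum.foldr-map-allFin (endTerm G end φ v)

module _ (G : Graph) where

  endSum-− : ∀ end (φ ψ : Fin (m G) → ℤ) v →
             endSum G end (λ e → φ e -ℤ ψ e) v ≡ endSum G end φ v -ℤ endSum G end ψ v
  endSum-− end φ ψ v = begin
    endSum G end (λ e → φ e -ℤ ψ e) v              ≡⟨ endSum≡sum G end _ ⟩
    ℤSum.sum (endTerm G end (λ e → φ e -ℤ ψ e) v)  ≡⟨ ℤSum.sum-cong-≗ endTerm-− ⟩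
    ℤSum.sum (λ e → out φ e -ℤ out ψ e)            ≡⟨ ℤSum.∑-− (out φ) (out ψ) ⟩
    ℤSum.sum (out φ) -ℤ ℤSum.sum (out ψ)           ≡⟨ cong₂ _-ℤ_ (endSum≡sum G end φ) (endSum≡sum G end ψ) ⟨
    endSum G end φ v -ℤ endSum G end ψ v           ∎
    where
    open ≡-Reasoning
    out : (Fin (m G) → ℤ) → Fin (m G) → ℤ
    out χ = endTerm G end χ v
    endTerm-− : ∀ e → endTerm G end (λ e → φ e -ℤ ψ e) v e ≡ out φ e -ℤ out ψ e
    endTerm-− e with end e ≟F v
    ... | yes _ = refl
    ... | no  _ = refl

  IsZFlow-− : ∀ {φ ψ} → IsZFlow G φ → IsZFlow G ψ → IsZFlow G (λ e → φ e -ℤ ψ e)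
  IsZFlow-− {φ} {ψ} φ-flow ψ-flow v = begin
    endSum G (tail G) (λ e → φ e -ℤ ψ e) v  ≡⟨ endSum-− (tail G) φ ψ v ⟩
    outSum G φ v -ℤ outSum G ψ v            ≡⟨ cong₂ _-ℤ_ (φ-flow v) (ψ-flow v) ⟩
    inSum G φ v -ℤ inSum G ψ v              ≡⟨ endSum-− (head G) φ ψ v ⟨
    endSum G (head G) (λ e → φ e -ℤ ψ e) v  ∎
    where open ≡-Reasoning

  IsCycleEdgeSet-resp : ∀ {C C′} → (∀ e → C e ≡ C′ e) → IsCycleEdgeSet G C → IsCycleEdgeSet G C′
  IsCycleEdgeSet-resp {C} {C′} C≗C′ ((e , Ce) , degree , connected) =
      (e , trans (sym (C≗C′ e)) Ce)
    , (λ v → subst (λ d → d ≡ 0 ⊎ d ≡ 2) (degIn-resp v) (degree v))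
    , λ e e′ C′e C′e′ → Reach-map (λ {d} → trans (sym (C≗C′ d)))
                          (connected e e′ (trans (C≗C′ e) C′e) (trans (C≗C′ e′) C′e′))
    where
    degIn-resp : ∀ v → degIn G C v ≡ degIn G C′ v
    degIn-resp v = cong ℕList.sum (map-cong (λ d → cong (λ b → if b ∧ _ then 1 else 0) (C≗C′ d)) (allFin _))

  supp-cong : ∀ {φ ψ} → (∀ e → φ e ≡ ψ e) → ∀ e → supp G φ e ≡ supp G ψ e
  supp-cong φ≗ψ e = cong (λ x → not ⌊ x ℤ.≟ + 0 ⌋) (φ≗ψ e)

degIn≡sum : ∀ G C v → degIn G C v ≡ ℕSum.sum (degTerm G C v)
degIn≡sum G C v = ℕSum.foldr-map-allFin (degTerm G C v)

module _ (G : Graph) (C : Fin (m G) → Bool) {v : Fin (n G)} {e : Fin (m G)} where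

  degTerm-false : C e ≡ false → degTerm G C v e ≡ 0
  degTerm-false Ce rewrite Ce = refl

  degTerm-¬incident : ¬ Incident G v e → degTerm G C v e ≡ 0
  degTerm-¬incident ¬inc with tail G e ≟F v | head G e ≟F v
  ... | yes t | _     = contradiction (inj₁ t) ¬inc
  ... | no  _ | yes h = contradiction (inj₂ h) ¬inc
  ... | no  _ | no  _ rewrite ∧-zeroʳ (C e) = refl

  degTerm-incident : C e ≡ true → Incident G v e → degTerm G C v e ≡ 1
  degTerm-incident Ce inc rewrite Ce with tail G e ≟F v | head G e ≟F v | inc
  ... | yes _ | _     | _      = refl
  ... | no  _ | yes _ | _      = refl
  ... | no  t | no  _ | inj₁ t′ = contradiction t′ t
  ... | no  _ | no  h | inj₂ h′ = contradiction h′ h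

-- Reorientation along a sign

module Reoriented (G : Graph) (σ : Fin (m G) → Sign) where

  tail′ head′ : Fin (m G) → Fin (n G)
  tail′ e with σ e
  ... | Sign.+ = tail G e
  ... | Sign.- = head G e
  head′ e with σ e
  ... | Sign.+ = head G e
  ... | Sign.- = tail G e

  tail′≢head′ : ∀ e → tail′ e ≢ head′ e
  tail′≢head′ e with σ e
  ... | Sign.+ = noLoop G e
  ... | Sign.- = noLoop G e ∘ sym

  incident-reoriented : ∀ {v e} → Incident G v e → tail′ e ≡ v ⊎ head′ e ≡ v
  incident-reoriented {e = e} inc with σ e | inc
  ... | Sign.+ | inc′ = inc′
  ... | Sign.- | inj₁ t = inj₂ t
  ... | Sign.- | inj₂ h = inj₁ h

  tail′-incident : ∀ {v e} → tail′ e ≡ v → Incident G v e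
  tail′-incident {e = e} t with σ e
  ... | Sign.+ = inj₁ t
  ... | Sign.- = inj₂ t

  head′-incident : ∀ {v e} → head′ e ≡ v → Incident G v e
  head′-incident {e = e} h with σ e
  ... | Sign.+ = inj₂ h
  ... | Sign.- = inj₁ h

  arc-reach : ∀ {A e} → A e → Reach G A (tail′ e) (head′ e)
  arc-reach {e = e} a with σ e
  ... | Sign.+ = fwd e a here
  ... | Sign.- = bwd e a here

  module _ (φ : Fin (m G) → ℤ) {c : ℕ} {e : Fin (m G)} {v : Fin (n G)} (φe : φ e ≡ σ e ◃ c) where

    leaving-balance : tail′ e ≡ v → endTerm G (tail G) φ v e ≡ endTerm G (head G) φ v e +ℤ + c
    leaving-balance t with σ e
    ... | Sign.+ = begin
      endTerm G (tail G) φ v e         ≡⟨ endTerm-≡ G (tail G) φ t ⟩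
      φ e                              ≡⟨ trans φe (ℤP.+◃n≡+n c) ⟩
      + c                              ≡⟨ ℤP.+-identityˡ (+ c) ⟨
      + 0 +ℤ + c                       ≡⟨ cong (_+ℤ + c) (endTerm-≢ G (head G) φ (noLoop G e ∘ trans t ∘ sym)) ⟨
      endTerm G (head G) φ v e +ℤ + c  ∎
      where open ≡-Reasoning
    ... | Sign.- = begin
      endTerm G (tail G) φ v e         ≡⟨ endTerm-≢ G (tail G) φ (λ t′ → noLoop G e (trans t′ (sym t))) ⟩
      + 0                              ≡⟨ ℤP.+-inverseˡ (+ c) ⟨
      ℤ.- + c +ℤ + c                   ≡⟨ cong (_+ℤ + c) (trans φe (ℤP.-◃n≡-n c)) ⟨
      φ e +ℤ + c                       ≡⟨ cong (_+ℤ + c) (endTerm-≡ G (head G) φ t) ⟨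
      endTerm G (head G) φ v e +ℤ + c  ∎
      where open ≡-Reasoning

    entering-balance : head′ e ≡ v → endTerm G (tail G) φ v e +ℤ + c ≡ endTerm G (head G) φ v e
    entering-balance h with σ e
    ... | Sign.+ = begin
      endTerm G (tail G) φ v e +ℤ + c  ≡⟨ cong (_+ℤ + c) (endTerm-≢ G (tail G) φ (λ t → noLoop G e (trans t (sym h)))) ⟩
      + 0 +ℤ + c                       ≡⟨ ℤP.+-identityˡ (+ c) ⟩
      + c                              ≡⟨ trans φe (ℤP.+◃n≡+n c) ⟨
      φ e                              ≡⟨ endTerm-≡ G (head G) φ h ⟨
      endTerm G (head G) φ v e         ∎
      where open ≡-Reasoning
    ... | Sign.- = begin
      endTerm G (tail G) φ v e +ℤ + c  ≡⟨ cong (_+ℤ + c) (endTerm-≡ G (tail G) φ h) ⟩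
      φ e +ℤ + c                       ≡⟨ cong (_+ℤ + c) (trans φe (ℤP.-◃n≡-n c)) ⟩
      ℤ.- + c +ℤ + c                   ≡⟨ ℤP.+-inverseˡ (+ c) ⟩
      + 0                              ≡⟨ endTerm-≢ G (head G) φ (noLoop G e ∘ trans h ∘ sym) ⟨
      endTerm G (head G) φ v e         ∎
      where open ≡-Reasoning

module _ (G : Graph) {f : Fin (m G) → ℤ} (f-flow : IsZFlow G f) (f-nz : ∀ e → f e ≢ + 0) where
  open Reoriented G (sign ∘ f)

  positive-out-arc : ∀ {v} → ∃ (Incident G v) → ∃ λ e → tail′ e ≡ v
  positive-out-arc {v} (e₀ , inc) with any? (λ e → tail′ e ≟F v)
  ... | yes leaving = leaving
  ... | no  none    = contradiction (f-flow v) (ℤP.<⇒≢ out<in)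
    where
    tail-nonpositive : ∀ {e} → tail G e ≡ v → f e ℤ.≤ + 0
    tail-nonpositive {e} t with f e | none ∘ (e ,_)
    ... | + zero   | _   = ℤP.≤-refl
    ... | +[1+ _ ] | ¬t′ = contradiction t ¬t′
    ... | -[1+ _ ] | _   = ℤ.-≤+

    head-nonnegative : ∀ {e} → head G e ≡ v → + 0 ℤ.≤ f e
    head-nonnegative {e} h with f e | none ∘ (e ,_)
    ... | + zero   | _   = ℤP.≤-refl
    ... | +[1+ _ ] | _   = ℤ.+≤+ ℕ.z≤n
    ... | -[1+ _ ] | ¬t′ = contradiction h ¬t′

    out≤0 : ∀ e → endTerm G (tail G) f v e ℤ.≤ + 0
    out≤0 e with tail G e ≟F v
    ... | yes t = tail-nonpositive t
    ... | no  _ = ℤP.≤-refl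

    0≤in : ∀ e → + 0 ℤ.≤ endTerm G (head G) f v e
    0≤in e with head G e ≟F v
    ... | yes h = head-nonnegative h
    ... | no  _ = ℤP.≤-refl

    out<in-at : Incident G v e₀ → endTerm G (tail G) f v e₀ ℤ.< endTerm G (head G) f v e₀
    out<in-at (inj₁ t) = ℤP.<-≤-trans
      (subst (ℤ._< + 0) (sym (endTerm-≡ G (tail G) f t)) (ℤP.≤∧≢⇒< (tail-nonpositive t) (f-nz e₀)))
      (0≤in e₀)
    out<in-at (inj₂ h) = ℤP.≤-<-trans (out≤0 e₀)
      (subst (+ 0 ℤ.<_) (sym (endTerm-≡ G (head G) f h)) (ℤP.≤∧≢⇒< (head-nonnegative h) (f-nz e₀ ∘ sym)))

    out<in : outSum G f v ℤ.< inSum G f v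
    out<in = subst₂ ℤ._<_ (sym (endSum≡sum G (tail G) f)) (sym (endSum≡sum G (head G) f))
      (ℤSum.∑-mono-< (λ e → ℤP.≤-trans (out≤0 e) (0≤in e)) e₀ (out<in-at inc))

-- Orbits of a self-map of a finite set

module PeriodicOrbit {k : ℕ} (s : Fin k → Fin k) where
  open import Function.Endo.Propositional (Fin k) using (_^_; ^-homo)

  ^-+ : ∀ a b x → (s ^ a) ((s ^ b) x) ≡ (s ^ (a ℕ.+ b)) x
  ^-+ a b x = sym (cong-app (^-homo s a b) x)

  ^-suc : ∀ a x → (s ^ a) (s x) ≡ s ((s ^ a) x)
  ^-suc a x = trans (^-+ a 1 x) (cong (λ b → (s ^ b) x) (ℕP.+-comm a 1))

  periodic-point : Fin k → ∃₂ λ u p → (s ^ suc p) u ≡ u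
  periodic-point x
    with i , j , i<j , sⁱx≡sʲx ← pigeonhole (ℕP.n<1+n k) (λ i → (s ^ toℕ i) x)
    with d , i+1+d≡j ← ℕP.m≤n⇒∃[o]m+o≡n i<j
    = (s ^ toℕ i) x , d , (begin
      (s ^ suc d) ((s ^ toℕ i) x)  ≡⟨ ^-+ (suc d) (toℕ i) x ⟩
      (s ^ (suc d ℕ.+ toℕ i)) x    ≡⟨ cong (λ a → (s ^ suc a) x) (ℕP.+-comm d (toℕ i)) ⟩
      (s ^ (suc (toℕ i) ℕ.+ d)) x  ≡⟨ cong (λ a → (s ^ a) x) i+1+d≡j ⟩
      (s ^ toℕ j) x                ≡⟨ sⁱx≡sʲx ⟨
      (s ^ toℕ i) x                ∎)
    where open ≡-Reasoning

  module OrbitOf {u : Fin k} {p : ℕ} (periodic : (s ^ suc p) u ≡ u) where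

    Orbit : Fin k → Set
    Orbit x = ∃ λ (a : Fin (suc p)) → (s ^ toℕ a) u ≡ x

    orbit? : Decidable Orbit
    orbit? x = any? (λ a → (s ^ toℕ a) u ≟F x)

    start∈orbit : Orbit u
    start∈orbit = zero , refl

    orbit-step : ∀ {x} → Orbit x → Orbit (s x)
    orbit-step (a , refl) with ℕP.m<1+n⇒m<n∨m≡n (toℕ<n a)
    ... | inj₁ a<p = fromℕ< (ℕ.s≤s a<p) , cong (λ b → (s ^ b) u) (toℕ-fromℕ< (ℕ.s≤s a<p))
    ... | inj₂ a≡p = zero , trans (sym periodic) (cong (λ b → (s ^ suc b) u) (sym a≡p))

    orbit-iterate : ∀ a {x} → Orbit x → Orbit ((s ^ a) x)
    orbit-iterate zero    o = o
    orbit-iterate (suc a) o = orbit-step (orbit-iterate a o)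

    orbit-periodic : ∀ {x} → Orbit x → (s ^ suc p) x ≡ x
    orbit-periodic (a , refl) = begin
      (s ^ suc p) ((s ^ toℕ a) u)  ≡⟨ ^-+ (suc p) (toℕ a) u ⟩
      (s ^ (suc p ℕ.+ toℕ a)) u    ≡⟨ cong (λ b → (s ^ b) u) (ℕP.+-comm (suc p) (toℕ a)) ⟩
      (s ^ (toℕ a ℕ.+ suc p)) u    ≡⟨ ^-+ (toℕ a) (suc p) u ⟨
      (s ^ toℕ a) ((s ^ suc p) u)  ≡⟨ cong (s ^ toℕ a) periodic ⟩
      (s ^ toℕ a) u                ∎
      where open ≡-Reasoning

    predecessor : Fin k → Fin k
    predecessor = s ^ p

    predecessor∈orbit : ∀ {x} → Orbit x → Orbit (predecessor x)
    predecessor∈orbit = orbit-iterate p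

    s-predecessor : ∀ {x} → Orbit x → s (predecessor x) ≡ x
    s-predecessor = orbit-periodic

    -- Any period p works here, not only the least one: x = s ^ p (s x) on the orbit.
    s-injective-on-orbit : ∀ {x y} → Orbit x → Orbit y → s x ≡ s y → x ≡ y
    s-injective-on-orbit {x} {y} ox oy sx≡sy = begin
      x              ≡⟨ orbit-periodic ox ⟨
      s ((s ^ p) x)  ≡⟨ ^-suc p x ⟨
      (s ^ p) (s x)  ≡⟨ cong (s ^ p) sx≡sy ⟩
      (s ^ p) (s y)  ≡⟨ ^-suc p y ⟩
      s ((s ^ p) y)  ≡⟨ orbit-periodic oy ⟩
      y              ∎
      where open ≡-Reasoning

-- The cycle traced by a successor choice

module Successor (G : Graph) (σ : Fin (m G) → Sign) (out : Fin (n G) → Fin (m G))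
                 (tail′-out : ∀ v → Reoriented.tail′ G σ (out v) ≡ v) where
  open Reoriented G σ

  next : Fin (n G) → Fin (n G)
  next v = head′ (out v)

  open PeriodicOrbit next public using (periodic-point)
  open import Function.Endo.Propositional (Fin (n G)) using (_^_)

  module Cycle {u : Fin (n G)} {p : ℕ} (periodic : (next ^ suc p) u ≡ u) where
    open PeriodicOrbit.OrbitOf next {u} {p} periodic

    InCycle : Fin (m G) → Set
    InCycle e = Orbit (tail′ e) × out (tail′ e) ≡ e

    inCycle? : Decidable InCycle
    inCycle? e = orbit? (tail′ e) ×-dec out (tail′ e) ≟F e

    cycle : Fin (m G) → Bool
    cycle e = ⌊ inCycle? e ⌋

    cycle-true : ∀ {e} → InCycle e → cycle e ≡ true
    cycle-true {e} c with inCycle? e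
    ... | yes _ = refl
    ... | no ¬c = contradiction c ¬c

    cycle-false : ∀ {e} → ¬ InCycle e → cycle e ≡ false
    cycle-false {e} ¬c with inCycle? e
    ... | yes c = contradiction c ¬c
    ... | no _  = refl

    cycle-true⁻¹ : ∀ {e} → cycle e ≡ true → InCycle e
    cycle-true⁻¹ {e} eq with inCycle? e
    ... | yes c = c
    ... | no  _ = contradiction eq λ ()

    out-inCycle : ∀ {v} → Orbit v → InCycle (out v)
    out-inCycle {v} o = subst Orbit (sym (tail′-out v)) o , cong out (tail′-out v)

    incident-orbit : ∀ {v e} → InCycle e → Incident G v e → Orbit v
    incident-orbit {e = e} (o , out≡e) inc with incident-reoriented inc
    ... | inj₁ refl = o
    ... | inj₂ refl = subst (Orbit ∘ head′) out≡e (orbit-step o)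

    cycle-edges-at : ∀ {v e} → Orbit v → InCycle e → Incident G v e →
                     e ≡ out v ⊎ e ≡ out (predecessor v)
    cycle-edges-at {e = e} o (oe , out≡e) inc with incident-reoriented inc
    ... | inj₁ refl = inj₁ (sym out≡e)
    ... | inj₂ refl = inj₂ (trans (sym out≡e) (cong out (s-injective-on-orbit oe (predecessor∈orbit o)
                        (trans (cong head′ out≡e) (sym (s-predecessor o))))))

    out≢out-predecessor : ∀ {v} → Orbit v → out v ≢ out (predecessor v)
    out≢out-predecessor {v} o eq = tail′≢head′ (out (predecessor v)) (begin
      tail′ (out (predecessor v))  ≡⟨ cong tail′ eq ⟨
      tail′ (out v)                ≡⟨ tail′-out v ⟩
      v                            ≡⟨ s-predecessor o ⟨
      head′ (out (predecessor v))  ∎)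
      where open ≡-Reasoning

    module _ {c ℓ} (M : CommutativeMonoid c ℓ) where
      open CommutativeMonoid M using (Carrier; _≈_; _∙_; ε)
      open FinSum M

      private
        zero-off-cycle-edges-at : ∀ {v} (φ : Fin (m G) → Carrier) → (∀ e → ¬ InCycle e → φ e ≈ ε) →
                                  (∀ e → ¬ Incident G v e → φ e ≈ ε) →
                                  ∀ e → ¬ (InCycle e × Incident G v e) → φ e ≈ ε
        zero-off-cycle-edges-at φ off-cycle off-v e ¬both with inCycle? e
        ... | yes c = off-v e (λ inc → ¬both (c , inc))
        ... | no ¬c = off-cycle e ¬c

      sum-around : ∀ {v} → Orbit v → (φ : Fin (m G) → Carrier) → (∀ e → ¬ InCycle e → φ e ≈ ε) →
                   (∀ e → ¬ Incident G v e → φ e ≈ ε) → sum φ ≈ φ (out v) ∙ φ (out (predecessor v))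
      sum-around o φ off-cycle off-v = sum-pair φ (out≢out-predecessor o) λ e e≢out e≢pred →
        zero-off-cycle-edges-at φ off-cycle off-v e λ (c , inc) → [ e≢out , e≢pred ] (cycle-edges-at o c inc)

      sum-away : ∀ {v} → ¬ Orbit v → (φ : Fin (m G) → Carrier) → (∀ e → ¬ InCycle e → φ e ≈ ε) →
                 (∀ e → ¬ Incident G v e → φ e ≈ ε) → sum φ ≈ ε
      sum-away ¬o φ off-cycle off-v = sum-zero φ λ e →
        zero-off-cycle-edges-at φ off-cycle off-v e λ (c , inc) → ¬o (incident-orbit c inc)

    cycleFlow : ℕ → Fin (m G) → ℤ
    cycleFlow c e = if cycle e then σ e ◃ c else + 0

    cycleFlow-on : ∀ {c e} → InCycle e → cycleFlow c e ≡ σ e ◃ c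
    cycleFlow-on ce rewrite cycle-true ce = refl

    cycleFlow-off : ∀ {c e} → ¬ InCycle e → cycleFlow c e ≡ + 0
    cycleFlow-off ¬ce rewrite cycle-false ¬ce = refl

    module _ (c : ℕ) {v : Fin (n G)} (end : Fin (m G) → Fin (n G))
             (end-incident : ∀ {e} → end e ≡ v → Incident G v e) where

      private
        off-cycle : ∀ e → ¬ InCycle e → endTerm G end (cycleFlow c) v e ≡ + 0
        off-cycle _ = endTerm-zero G end (cycleFlow c) ∘ cycleFlow-off

        off-v : ∀ e → ¬ Incident G v e → endTerm G end (cycleFlow c) v e ≡ + 0
        off-v _ ¬inc = endTerm-≢ G end (cycleFlow c) (¬inc ∘ end-incident)

      endSum-cycleFlow-around : Orbit v → endSum G end (cycleFlow c) v ≡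
        endTerm G end (cycleFlow c) v (out v) +ℤ endTerm G end (cycleFlow c) v (out (predecessor v))
      endSum-cycleFlow-around o = trans (endSum≡sum G end (cycleFlow c))
        (sum-around ℤP.+-0-commutativeMonoid o _ off-cycle off-v)

      endSum-cycleFlow-away : ¬ Orbit v → endSum G end (cycleFlow c) v ≡ + 0
      endSum-cycleFlow-away ¬o = trans (endSum≡sum G end (cycleFlow c))
        (sum-away ℤP.+-0-commutativeMonoid ¬o _ off-cycle off-v)

    cycleFlow-isFlow : ∀ c → IsZFlow G (cycleFlow c)
    cycleFlow-isFlow c v with orbit? v
    ... | no ¬o = trans (endSum-cycleFlow-away c (tail G) inj₁ ¬o)
                        (sym (endSum-cycleFlow-away c (head G) inj₂ ¬o))
    ... | yes o = begin
      outSum G (cycleFlow c) v         ≡⟨ endSum-cycleFlow-around c (tail G) inj₁ o ⟩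
      atTail e₊ +ℤ atTail e₋           ≡⟨ cong (_+ℤ atTail e₋) leaves ⟩
      (atHead e₊ +ℤ + c) +ℤ atTail e₋  ≡⟨ ℤP.+-assoc (atHead e₊) (+ c) (atTail e₋) ⟩
      atHead e₊ +ℤ (+ c +ℤ atTail e₋)  ≡⟨ cong (atHead e₊ +ℤ_) (ℤP.+-comm (+ c) (atTail e₋)) ⟩
      atHead e₊ +ℤ (atTail e₋ +ℤ + c)  ≡⟨ cong (atHead e₊ +ℤ_) enters ⟩
      atHead e₊ +ℤ atHead e₋           ≡⟨ endSum-cycleFlow-around c (head G) inj₂ o ⟨
      inSum G (cycleFlow c) v          ∎
      where
      open ≡-Reasoning
      e₊ e₋ : Fin (m G)
      e₊ = out v
      e₋ = out (predecessor v)
      atTail atHead : Fin (m G) → ℤ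
      atTail = endTerm G (tail G) (cycleFlow c) v
      atHead = endTerm G (head G) (cycleFlow c) v
      leaves : atTail e₊ ≡ atHead e₊ +ℤ + c
      leaves = leaving-balance (cycleFlow c) (cycleFlow-on (out-inCycle o)) (tail′-out v)
      enters : atTail e₋ +ℤ + c ≡ atHead e₋
      enters = entering-balance (cycleFlow c) (cycleFlow-on (out-inCycle (predecessor∈orbit o)))
                                (s-predecessor o)

    supp-cycleFlow : ∀ c e → supp G (cycleFlow (suc c)) e ≡ cycle e
    supp-cycleFlow c e with inCycle? e
    ... | no  _ = refl
    ... | yes _ with σ e
    ...   | Sign.+ = refl
    ...   | Sign.- = refl

    degTerm-off-cycle : ∀ {v} e → ¬ InCycle e → degTerm G cycle v e ≡ 0
    degTerm-off-cycle _ = degTerm-false G cycle ∘ cycle-false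

    cycle-degree : ∀ v → degIn G cycle v ≡ 0 ⊎ degIn G cycle v ≡ 2
    cycle-degree v with orbit? v
    ... | no ¬o = inj₁ (trans (degIn≡sum G cycle v)
      (sum-away ℕP.+-0-commutativeMonoid ¬o _ degTerm-off-cycle (λ _ → degTerm-¬incident G cycle)))
    ... | yes o = inj₂ (begin
      degIn G cycle v                                ≡⟨ degIn≡sum G cycle v ⟩
      ℕSum.sum (degTerm G cycle v)                   ≡⟨ sum-around ℕP.+-0-commutativeMonoid o _
                                                          degTerm-off-cycle (λ _ → degTerm-¬incident G cycle) ⟩
      degTerm G cycle v e₊ ℕ.+ degTerm G cycle v e₋  ≡⟨ cong₂ ℕ._+_ at-e₊ at-e₋ ⟩
      2                                              ∎)
      where
      open ≡-Reasoning
      e₊ e₋ : Fin (m G)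
      e₊ = out v
      e₋ = out (predecessor v)
      at-e₊ : degTerm G cycle v e₊ ≡ 1
      at-e₊ = degTerm-incident G cycle (cycle-true (out-inCycle o)) (tail′-incident (tail′-out v))
      at-e₋ : degTerm G cycle v e₋ ≡ 1
      at-e₋ = degTerm-incident G cycle (cycle-true (out-inCycle (predecessor∈orbit o)))
                               (head′-incident (s-predecessor o))

    reach-orbit : ∀ {x} → Orbit x → Reach G (λ e → cycle e ≡ true) u x
    reach-orbit (a , refl) = reach-iterate (toℕ a)
      where
      step : ∀ {x} → Orbit x → Reach G (λ e → cycle e ≡ true) x (next x)
      step {x} o = subst (λ y → Reach G (λ e → cycle e ≡ true) y (next x)) (tail′-out x)
                         (arc-reach (cycle-true (out-inCycle o)))
      reach-iterate : ∀ a → Reach G (λ e → cycle e ≡ true) u ((next ^ a) u)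
      reach-iterate zero    = here
      reach-iterate (suc a) = Reach-trans (reach-iterate a) (step (orbit-iterate a start∈orbit))

    cycle-isCycle : IsCycleEdgeSet G cycle
    cycle-isCycle =
        (out u , cycle-true (out-inCycle start∈orbit))
      , cycle-degree
      , λ e e′ Ce Ce′ → Reach-trans (Reach-sym (reach-orbit (tail∈orbit Ce))) (reach-orbit (tail∈orbit Ce′))
      where
      tail∈orbit : ∀ {e} → cycle e ≡ true → Orbit (tail G e)
      tail∈orbit Ce = incident-orbit (cycle-true⁻¹ Ce) (inj₁ refl)

module Rerouting (G : Graph) {k : ℕ} {f : Fin (m G) → ℤ}
                 (f-flow : IsZFlow G f) (f-bounded : ∀ e → ∣ f e ∣ < suc k) (f-nz : ∀ e → f e ≢ + 0)
                 (v₀ : Fin (n G)) (no-isolated : ∀ v → ∃ (Incident G v)) where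
  open Reoriented G (sign ∘ f)

  positive-out-arcs : ∀ v → ∃ λ e → tail′ e ≡ v
  positive-out-arcs v = positive-out-arc G f-flow f-nz (no-isolated v)

  open Successor G (sign ∘ f) (proj₁ ∘ positive-out-arcs) (proj₂ ∘ positive-out-arcs)
  open Cycle {proj₁ (periodic-point v₀)} {proj₁ (proj₂ (periodic-point v₀))}
             (proj₂ (proj₂ (periodic-point v₀)))

  rerouted : Fin (m G) → ℤ
  rerouted e = f e -ℤ cycleFlow (suc k) e

  rerouted-entry : ∀ e → ∣ rerouted e ∣ < suc k × rerouted e ≢ + 0
  rerouted-entry e with inCycle? e
  ... | yes _ = sign-shift-in-range (f e) (f-nz e) (f-bounded e)
  ... | no  _ rewrite ℤP.+-identityʳ (f e) = f-bounded e , f-nz e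

  rerouted-isNZkFlow : IsNZkFlow G (suc k) rerouted
  rerouted-isNZkFlow =
    IsZFlow-− G f-flow (cycleFlow-isFlow (suc k)) , proj₁ ∘ rerouted-entry , proj₂ ∘ rerouted-entry

  rerouted-adjacent : AdjacentFlows G f rerouted
  rerouted-adjacent = IsCycleEdgeSet-resp G supp≗cycle cycle-isCycle
    where
    supp≗cycle : ∀ e → cycle e ≡ supp G (λ d → f d -ℤ rerouted d) e
    supp≗cycle e = sym (trans (supp-cong G (λ d → x-[x-y]≡y (f d) (cycleFlow (suc k) d)) e)
                              (supp-cycleFlow k e))

theorem3p4 : (G : Graph) → (k : ℕ) → 2 ≤ k → TwoEdgeConnected G →
    (f : Fin (m G) → ℤ) → IsNZkFlow G k f →
    ∃ λ (g : Fin (m G) → ℤ) → IsNZkFlow G k g × AdjacentFlows G f g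
theorem3p4 G zero    () _ _ _
theorem3p4 G (suc k) _  (two , connected , _) f (f-flow , f-bounded , f-nz) =
  rerouted , rerouted-isNZkFlow , rerouted-adjacent
  where open Rerouting G f-flow f-bounded f-nz (fromℕ< two) (no-isolated-vertex two connected)
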